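{- Let $T$ be a tree (without loops) and $e=uv$ an edge of $T$. Then $\nu_2(T)-\nu_2(T\setminus e)\in\{0,1\}$, and \[ \nu_2(T)-\nu_2(T\setminus e)=\begin{cases}0 & \text{if and only if } u \text{ or } v \text{ is saturated in } T\setminus e,\\ 1 & \text{if and only if } e \text{ is saturated in } T.\end{cases} \]
   Context: A tree is a finite simple connected graph without cycles; $T\setminus e$ is obtained by deleting the edge $e$ (a forest). A $2$-matching of a graph is a set of edges such that every vertex is incident to at most two of them; $\nu_2(G)$ is the maximum size of a $2$-matching of $G$, and a $2$-matching of that size is maximum. A vertex is saturated in $G$ if every maximum $2$-matching of $G$ contains two edges incident to it; an edge is saturated in $G$ if it belongs to every maximum $2$-matching of $G$. -}

module Defs where

open import Data.Nat using (ℕ; suc; _≤_)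
open import Data.Bool using (Bool; true; _∧_; _∨_)
open import Data.Fin using (Fin; _≟_; punchIn)
open import Data.Fin.Properties using (punchIn-injective)
open import Data.Fin.Subset using (Subset; _∈_; ∣_∣)
open import Data.Product using (_×_; _,_; proj₁; proj₂; ∃; ∃-syntax)
open import Data.Sum using (_⊎_)
open import Data.Empty using (⊥)
open import Data.List using (List; []; _∷_; length; last)
open import Data.Maybe using (just)
open import Data.List.Relation.Unary.Linked using (Linked)
open import Data.List.Relation.Unary.Unique.Propositional using (Unique)
open import Data.Vec using (lookup; allFin; countᵇ)
open import Relation.Binary.PropositionalEquality using (_≡_; _≢_)
open import Relation.Nullary using (¬_)
open import Relation.Nullary.Decidable using (isYes)

record Graph (n m : ℕ) : Set where
  field
    edge     : Fin m → Fin n × Fin n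
    loopless : ∀ i → proj₁ (edge i) ≢ proj₂ (edge i)
    -- no parallel edges: distinct indices give distinct unordered pairs
    noMulti  : ∀ i j → i ≢ j →
               edge i ≢ edge j × edge i ≢ (proj₂ (edge j) , proj₁ (edge j))
open Graph public

module _ {n m : ℕ} (G : Graph n m) where

  Incident : Fin n → Fin m → Set
  Incident v i = proj₁ (edge G i) ≡ v ⊎ proj₂ (edge G i) ≡ v

  Adj : Fin n → Fin n → Set
  Adj u v = ∃[ i ] (edge G i ≡ (u , v) ⊎ edge G i ≡ (v , u))

  data Walk : Fin n → Fin n → Set where
    here : ∀ {u} → Walk u u
    step : ∀ {u w v} → Adj u w → Walk w v → Walk u v

  Connected : Set
  Connected = ∀ u v → Walk u v

  IsCycle : List (Fin n) → Set
  IsCycle [] = ⊥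
  IsCycle (v ∷ vs) =
    2 ≤ length vs × Unique (v ∷ vs) × Linked Adj (v ∷ vs) ×
    ∃[ w ] (last (v ∷ vs) ≡ just w × Adj w v)

  Acyclic : Set
  Acyclic = ∀ cs → ¬ IsCycle cs

  IsTree : Set
  IsTree = Connected × Acyclic

  deg : Subset m → Fin n → ℕ
  deg S v = countᵇ (λ i → lookup S i ∧
                          (isYes (proj₁ (edge G i) ≟ v) ∨ isYes (proj₂ (edge G i) ≟ v)))
                   (allFin m)

  Is2Matching : Subset m → Set
  Is2Matching S = ∀ v → deg S v ≤ 2

  IsMaximum2Matching : Subset m → Set
  IsMaximum2Matching S = Is2Matching S × (∀ S' → Is2Matching S' → ∣ S' ∣ ≤ ∣ S ∣)

  IsNu2 : ℕ → Set
  IsNu2 k = (∃[ S ] (Is2Matching S × ∣ S ∣ ≡ k)) × (∀ S → Is2Matching S → ∣ S ∣ ≤ k)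

  SaturatedVertex : Fin n → Set
  SaturatedVertex v = ∀ S → IsMaximum2Matching S → deg S v ≡ 2

  SaturatedEdge : Fin m → Set
  SaturatedEdge i = ∀ S → IsMaximum2Matching S → i ∈ S

deleteEdge : ∀ {n m} → Graph n (suc m) → Fin (suc m) → Graph n m
deleteEdge G e = record
  { edge     = λ i → edge G (punchIn e i)
  ; loopless = λ i → loopless G (punchIn e i)
  ; noMulti  = λ i j i≢j → noMulti G (punchIn e i) (punchIn e j)
                              (λ p → i≢j (punchIn-injective e i j p))
  }

-- Every 2-matching of T ∖ e is one of T, and deleting e from a 2-matching of T
-- loses at most one edge, so ν₂ drops by 0 or 1.  If it drops, every maximum
-- 2-matching of T contains e, and deleting e from it leaves a maximum 2-matching
-- of T ∖ e in which u and v have degree at most 1; so neither endpoint is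
-- saturated in T ∖ e.  Conversely, suppose ν₂ does not drop and neither endpoint
-- is saturated: there are maximum 2-matchings X, Y of T ∖ e with room at u and
-- at v respectively.  As T is acyclic, u and v lie in different components of
-- T ∖ e; taking X on the component of u and Y elsewhere gives a maximum
-- 2-matching of T ∖ e with room at both u and v, and adding e to it beats ν₂(T).
module Submission where

open import Defs
open import Data.Bool using (Bool; true; false; _∧_; _∨_; if_then_else_)
open import Data.Bool.Properties using (∧-zeroʳ; if-float; if-cong)
open import Data.Empty using (⊥; ⊥-elim)
open import Data.Fin using (Fin; zero; suc; punchIn; _≟_)
open import Data.Fin.Properties using (punchInᵢ≢i; all?; sequence)
open import Data.Fin.Subset using (Subset; ∣_∣)
open import Data.Fin.Subset.Properties using (anySubset?)
open import Data.List using (List; []; _∷_; last; length)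
open import Data.List.Membership.Propositional using () renaming (_∈_ to _∈ˡ_)
import Data.List.Relation.Unary.All as All
open import Data.List.Relation.Unary.All.Properties using (¬Any⇒All¬)
open import Data.List.Relation.Unary.Any using (here; there; any?)
open import Data.List.Relation.Unary.AllPairs using ([]; _∷_)
open import Data.List.Relation.Unary.Linked as Linked using (Linked; [-]; _∷_)
open import Data.List.Relation.Unary.Unique.Propositional using (Unique)
open import Data.Maybe using (just)
open import Data.Maybe.Properties using (just-injective)
open import Data.Nat using (ℕ; suc; _+_; _≤_; s≤s; s≤s⁻¹; z≤n)
open import Data.Nat.Properties
  using ( ≤-antisym; ≤-trans; m≤n+m; +-comm; +-mono-≤; +-monoʳ-≤; +-cancelʳ-≤; ≰⇒>; 1+n≰n
        ; suc-injective; m≤n⇒m<n∨m≡n; +-0-commutativeMonoid; module ≤-Reasoning )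
  renaming (_≟_ to _≟ℕ_; _≤?_ to _≤ℕ?_)
open import Algebra.Properties.CommutativeMonoid.Sum +-0-commutativeMonoid
  using (sum-syntax; sum-cong-≗; sum-remove; ∑-distrib-+)
open import Data.Product using (_×_; _,_; proj₁; proj₂; ∃-syntax)
open import Data.Sum using (_⊎_; inj₁; inj₂; [_,_])
open import Data.Vec using (Vec; []; _∷_; lookup; tabulate; insertAt; removeAt; count)
open import Data.Vec.Properties
  using (insertAt-lookup; insertAt-punchIn; insertAt-removeAt; lookup∘tabulate; []=⇒lookup; lookup⇒[]=)
open import Function using (_∘_; _⇔_; mk⇔)
open import Relation.Binary.PropositionalEquality using (_≡_; refl; sym; trans; cong; cong₂; subst; module ≡-Reasoning)
open import Relation.Nullary using (¬_; Dec; yes; no; does)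
open import Relation.Nullary.Decidable using (isYes; dec-true; dec-false; _×-dec_)
open import Relation.Nullary.Decidable.Core using (T?; ¬¬-excluded-middle)
open import Relation.Nullary.Negation using (¬¬-Monad)
open import Relation.Unary using (Pred; Decidable)
open import Effect.Monad using (RawMonad)

boolToℕ : Bool → ℕ
boolToℕ false = 0
boolToℕ true  = 1

count-tabulate : ∀ {a p} {A : Set a} {P : Pred A p} (P? : Decidable P) {m} (f : Fin m → A) →
                 count P? (tabulate f) ≡ ∑[ i < m ] boolToℕ (does (P? (f i)))
count-tabulate P? {0}     f = refl
count-tabulate P? {suc m}  f with does (P? (f zero))
... | true  = cong suc (count-tabulate P? (f ∘ suc))
... | false = count-tabulate P? (f ∘ suc)

∣p∣≡∑ : ∀ {m} (p : Subset m) → ∣ p ∣ ≡ ∑[ i < m ] boolToℕ (lookup p i)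
∣p∣≡∑ []          = refl
∣p∣≡∑ (true ∷ p)  = cong suc (∣p∣≡∑ p)
∣p∣≡∑ (false ∷ p) = ∣p∣≡∑ p

∣tabulate∣≡∑ : ∀ {m} (f : Fin m → Bool) → ∣ tabulate f ∣ ≡ ∑[ i < m ] boolToℕ (f i)
∣tabulate∣≡∑ f = trans (∣p∣≡∑ (tabulate f)) (sum-cong-≗ (cong boolToℕ ∘ lookup∘tabulate f))

∑-insertAt : ∀ {a} {A : Set a} {m} (f : Fin (suc m) → A → ℕ) (xs : Vec A m) (i : Fin (suc m)) (x : A) →
             ∑[ j < suc m ] f j (lookup (insertAt xs i x) j) ≡ f i x + ∑[ j < m ] f (punchIn i j) (lookup xs j)
∑-insertAt f xs i x = trans (sum-remove {i = i} (λ j → f j (lookup (insertAt xs i x) j)))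
  (cong₂ _+_ (cong (f i) (insertAt-lookup xs i x))
             (sum-cong-≗ (λ j → cong (f (punchIn i j)) (insertAt-punchIn xs i x j))))

∣insertAt∣ : ∀ {m} (p : Subset m) (i : Fin (suc m)) (b : Bool) → ∣ insertAt p i b ∣ ≡ boolToℕ b + ∣ p ∣
∣insertAt∣ p i b = begin
  ∣ insertAt p i b ∣                                ≡⟨ ∣p∣≡∑ (insertAt p i b) ⟩
  ∑[ j < _ ] boolToℕ (lookup (insertAt p i b) j)    ≡⟨ ∑-insertAt (λ _ → boolToℕ) p i b ⟩
  boolToℕ b + ∑[ j < _ ] boolToℕ (lookup p j)       ≡⟨ cong (boolToℕ b +_) (sym (∣p∣≡∑ p)) ⟩
  boolToℕ b + ∣ p ∣                                 ∎
  where open ≡-Reasoning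

∣removeAt∣ : ∀ {m} (p : Subset (suc m)) (i : Fin (suc m)) → ∣ p ∣ ≡ boolToℕ (lookup p i) + ∣ removeAt p i ∣
∣removeAt∣ p i = trans (cong ∣_∣ (sym (insertAt-removeAt p i))) (∣insertAt∣ (removeAt p i) i (lookup p i))

boolToℕ≤1 : ∀ b → boolToℕ b ≤ 1
boolToℕ≤1 false = z≤n
boolToℕ≤1 true  = s≤s z≤n

∧-cong-when : ∀ a b c → (c ≡ true → a ≡ b) → a ∧ c ≡ b ∧ c
∧-cong-when a b false _   = trans (∧-zeroʳ a) (sym (∧-zeroʳ b))
∧-cong-when a b true  a≡b = cong (_∧ true) (a≡b refl)

boolToℕ-if-swap : ∀ s x y → boolToℕ (if s then x else y) + boolToℕ (if s then y else x) ≡ boolToℕ x + boolToℕ y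
boolToℕ-if-swap true  x y = refl
boolToℕ-if-swap false x y = +-comm (boolToℕ y) (boolToℕ x)

module _ {n m : ℕ} (G : Graph n m) where

  incidentᵇ : Fin m → Fin n → Bool
  incidentᵇ i w = isYes (proj₁ (edge G i) ≟ w) ∨ isYes (proj₂ (edge G i) ≟ w)

  incidentᵇ⇒Incident : ∀ {i w} → incidentᵇ i w ≡ true → Incident G w i
  incidentᵇ⇒Incident {i} {w} eq with proj₁ (edge G i) ≟ w | proj₂ (edge G i) ≟ w
  ... | yes p | _     = inj₁ p
  ... | no _  | yes q = inj₂ q
  incidentᵇ⇒Incident () | no _ | no _

  Incident⇒incidentᵇ : ∀ {i w} → Incident G w i → incidentᵇ i w ≡ true
  Incident⇒incidentᵇ {i} {w} w∈i with proj₁ (edge G i) ≟ w | proj₂ (edge G i) ≟ w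
  ... | yes _ | _     = refl
  ... | no _  | yes _ = refl
  ... | no ¬p | no ¬q = ⊥-elim ([ ¬p , ¬q ] w∈i)

  deg≡∑ : ∀ S w → deg G S w ≡ ∑[ i < m ] boolToℕ (lookup S i ∧ incidentᵇ i w)
  deg≡∑ S w = count-tabulate (T? ∘ λ i → lookup S i ∧ incidentᵇ i w) (λ i → i)

  deg-cong : ∀ S S′ w → (∀ i → Incident G w i → lookup S i ≡ lookup S′ i) → deg G S w ≡ deg G S′ w
  deg-cong S S′ w S≗S′ = begin
    deg G S w                                           ≡⟨ deg≡∑ S w ⟩
    ∑[ i < m ] boolToℕ (lookup S i ∧ incidentᵇ i w)     ≡⟨ sum-cong-≗ agree ⟩
    ∑[ i < m ] boolToℕ (lookup S′ i ∧ incidentᵇ i w)    ≡⟨ sym (deg≡∑ S′ w) ⟩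
    deg G S′ w                                          ∎
    where
    open ≡-Reasoning
    agree : ∀ i → boolToℕ (lookup S i ∧ incidentᵇ i w) ≡ boolToℕ (lookup S′ i ∧ incidentᵇ i w)
    agree i = cong boolToℕ (∧-cong-when _ _ (incidentᵇ i w) (S≗S′ i ∘ incidentᵇ⇒Incident))

  is2Matching? : ∀ S → Dec (Is2Matching G S)
  is2Matching? S = all? (λ w → deg G S w ≤ℕ? 2)

  module _ {k : ℕ} (ν : IsNu2 G k) where

    size⇒maximum : ∀ S → Is2Matching G S → ∣ S ∣ ≡ k → IsMaximum2Matching G S
    size⇒maximum S S₂ refl = S₂ , proj₂ ν

    maximum⇒size : ∀ S → IsMaximum2Matching G S → ∣ S ∣ ≡ k
    maximum⇒size S (S₂ , S-max) with proj₁ ν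
    ... | W , W₂ , refl = ≤-antisym (proj₂ ν S S₂) (S-max W W₂)

    -- Constructive because the search over all edge sets is finite.
    saturated⊎unsaturating : ∀ w →
      SaturatedVertex G w ⊎ ∃[ S ] (Is2Matching G S × ∣ S ∣ ≡ k × deg G S w ≤ 1)
    saturated⊎unsaturating w
      with anySubset? (λ S → is2Matching? S ×-dec (∣ S ∣ ≟ℕ k ×-dec deg G S w ≤ℕ? 1))
    ... | yes witness = inj₂ witness
    ... | no ¬witness = inj₁ λ S S-max →
      ≤-antisym (proj₁ S-max w) (≰⇒> λ d≤1 → ¬witness (S , proj₁ S-max , maximum⇒size S S-max , d≤1))

ConstantOnEdges : ∀ {n m} → Graph n m → (Fin n → Bool) → Set
ConstantOnEdges G A = ∀ i → A (proj₁ (edge G i)) ≡ A (proj₂ (edge G i))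

module _ {n m : ℕ} (G : Graph n m) (A : Fin n → Bool) (A-const : ConstantOnEdges G A) where

  glue : Subset m → Subset m → Subset m
  glue X Y = tabulate λ i → if A (proj₁ (edge G i)) then lookup X i else lookup Y i

  deg-glue : ∀ X Y w → deg G (glue X Y) w ≡ deg G (if A w then X else Y) w
  deg-glue X Y w = deg-cong G (glue X Y) (if A w then X else Y) w agree
    where
    side : ∀ {i} → Incident G w i → A (proj₁ (edge G i)) ≡ A w
    side (inj₁ p)     = cong A p
    side {i} (inj₂ q) = trans (A-const i) (cong A q)
    agree : ∀ i → Incident G w i → lookup (glue X Y) i ≡ lookup (if A w then X else Y) i
    agree i w∈i = trans (lookup∘tabulate _ i)
                        (trans (if-cong (side w∈i)) (sym (if-float (λ Z → lookup Z i) (A w))))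

  ∣glue∣+∣glue∣ : ∀ X Y → ∣ glue X Y ∣ + ∣ glue Y X ∣ ≡ ∣ X ∣ + ∣ Y ∣
  ∣glue∣+∣glue∣ X Y = begin
    ∣ glue X Y ∣ + ∣ glue Y X ∣
      ≡⟨ cong₂ _+_ (∣tabulate∣≡∑ (λ i → side i X Y)) (∣tabulate∣≡∑ (λ i → side i Y X)) ⟩
    ∑[ i < m ] boolToℕ (side i X Y) + ∑[ i < m ] boolToℕ (side i Y X)
      ≡⟨ sym (∑-distrib-+ (λ i → boolToℕ (side i X Y)) (λ i → boolToℕ (side i Y X))) ⟩
    ∑[ i < m ] (boolToℕ (side i X Y) + boolToℕ (side i Y X))
      ≡⟨ sum-cong-≗ (λ i → boolToℕ-if-swap (A (proj₁ (edge G i))) (lookup X i) (lookup Y i)) ⟩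
    ∑[ i < m ] (boolToℕ (lookup X i) + boolToℕ (lookup Y i))
      ≡⟨ ∑-distrib-+ (λ i → boolToℕ (lookup X i)) (λ i → boolToℕ (lookup Y i)) ⟩
    ∑[ i < m ] boolToℕ (lookup X i) + ∑[ i < m ] boolToℕ (lookup Y i)
      ≡⟨ sym (cong₂ _+_ (∣p∣≡∑ X) (∣p∣≡∑ Y)) ⟩
    ∣ X ∣ + ∣ Y ∣ ∎
    where
    open ≡-Reasoning
    side : Fin m → Subset m → Subset m → Bool
    side i X Y = if A (proj₁ (edge G i)) then lookup X i else lookup Y i

  glue-2matching : ∀ X Y → Is2Matching G X → Is2Matching G Y → Is2Matching G (glue X Y)
  glue-2matching X Y X₂ Y₂ w = subst (_≤ 2) (sym (deg-glue X Y w)) (chosen (A w))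
    where
    chosen : ∀ b → deg G (if b then X else Y) w ≤ 2
    chosen true  = X₂ w
    chosen false = Y₂ w

  -- Both gluings are 2-matchings, so neither exceeds k, while their sizes add up to 2k.
  ∣glue∣-maximum : ∀ {k} X Y → IsNu2 G k →
    Is2Matching G X → ∣ X ∣ ≡ k → Is2Matching G Y → ∣ Y ∣ ≡ k → ∣ glue X Y ∣ ≡ k
  ∣glue∣-maximum {k} X Y ν X₂ |X| Y₂ |Y| =
    ≤-antisym (proj₂ ν (glue X Y) (glue-2matching X Y X₂ Y₂)) (+-cancelʳ-≤ (∣ glue Y X ∣) k (∣ glue X Y ∣) (begin
      k + ∣ glue Y X ∣              ≤⟨ +-monoʳ-≤ k (proj₂ ν (glue Y X) (glue-2matching Y X Y₂ X₂)) ⟩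
      k + k                         ≡⟨ sym (cong₂ _+_ |X| |Y|) ⟩
      ∣ X ∣ + ∣ Y ∣                 ≡⟨ sym (∣glue∣+∣glue∣ X Y) ⟩
      ∣ glue X Y ∣ + ∣ glue Y X ∣   ∎))
    where open ≤-Reasoning

suffix-from : ∀ {a r} {A : Set a} {R : A → A → Set r} {x} (ys : List A) → x ∈ˡ ys →
              Unique ys → Linked R ys → ∃[ zs ] (Unique (x ∷ zs) × Linked R (x ∷ zs) × last (x ∷ zs) ≡ last ys)
suffix-from (y ∷ ys)      (here refl) uniq       linked       = ys , uniq , linked , refl
suffix-from (y ∷ [])      (there ())
suffix-from (y ∷ y′ ∷ ys) (there x∈)  (_ ∷ uniq) (_ ∷ linked) = suffix-from (y′ ∷ ys) x∈ uniq linked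

module _ {n m : ℕ} (G : Graph n m) where

  SimplePath : Fin n → Fin n → Set
  SimplePath w t = ∃[ xs ] (Unique (w ∷ xs) × Linked (Adj G) (w ∷ xs) × last (w ∷ xs) ≡ just t)

  simplePath-refl : ∀ t → SimplePath t t
  simplePath-refl t = [] , All.[] ∷ [] , [-] , refl

  simplePath-∷ : ∀ {w x t} → Adj G w x → SimplePath x t → SimplePath w t
  simplePath-∷ {w} {x} w~x (xs , uniq , linked , end) with any? (w ≟_) (x ∷ xs)
  ... | yes w∈ with suffix-from (x ∷ xs) w∈ uniq linked
  ...   | zs , uniq′ , linked′ , end′ = zs , uniq′ , linked′ , trans end′ end
  simplePath-∷ {w} {x} w~x (xs , uniq , linked , end) | no w∉ =
    x ∷ xs , ¬Any⇒All¬ (x ∷ xs) w∉ ∷ uniq , w~x ∷ linked , end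

module _ {n m : ℕ} (T : Graph n (suc m)) (e : Fin (suc m)) where

  private
    T∖e = deleteEdge T e
    u = proj₁ (edge T e)
    v = proj₂ (edge T e)

  deg-insertAt : ∀ S b w → deg T (insertAt S e b) w ≡ boolToℕ (b ∧ incidentᵇ T e w) + deg T∖e S w
  deg-insertAt S b w = begin
    deg T (insertAt S e b) w
      ≡⟨ deg≡∑ T (insertAt S e b) w ⟩
    ∑[ i < suc m ] boolToℕ (lookup (insertAt S e b) i ∧ incidentᵇ T i w)
      ≡⟨ ∑-insertAt (λ i x → boolToℕ (x ∧ incidentᵇ T i w)) S e b ⟩
    boolToℕ (b ∧ incidentᵇ T e w) + ∑[ i < m ] boolToℕ (lookup S i ∧ incidentᵇ T∖e i w)
      ≡⟨ cong (boolToℕ (b ∧ incidentᵇ T e w) +_) (sym (deg≡∑ T∖e S w)) ⟩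
    boolToℕ (b ∧ incidentᵇ T e w) + deg T∖e S w ∎
    where open ≡-Reasoning

  deg-removeAt : ∀ S w → deg T S w ≡ boolToℕ (lookup S e ∧ incidentᵇ T e w) + deg T∖e (removeAt S e) w
  deg-removeAt S w =
    trans (cong (λ S′ → deg T S′ w) (sym (insertAt-removeAt S e))) (deg-insertAt (removeAt S e) (lookup S e) w)

  insertAt-false-2matching : ∀ S → Is2Matching T∖e S → Is2Matching T (insertAt S e false)
  insertAt-false-2matching S S₂ w = subst (_≤ 2) (sym (deg-insertAt S false w)) (S₂ w)

  insertAt-true-2matching : ∀ S → Is2Matching T∖e S → deg T∖e S u ≤ 1 → deg T∖e S v ≤ 1 →
                            Is2Matching T (insertAt S e true)
  insertAt-true-2matching S S₂ u≤1 v≤1 w =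
    subst (_≤ 2) (sym (deg-insertAt S true w)) (bounded w (incidentᵇ T e w) refl)
    where
    bounded : ∀ w b → incidentᵇ T e w ≡ b → boolToℕ b + deg T∖e S w ≤ 2
    bounded w false _   = S₂ w
    bounded w true  w∈e with incidentᵇ⇒Incident T w∈e
    ... | inj₁ refl = s≤s u≤1
    ... | inj₂ refl = s≤s v≤1

  removeAt-2matching : ∀ S → Is2Matching T S → Is2Matching T∖e (removeAt S e)
  removeAt-2matching S S₂ w = ≤-trans (m≤n+m _ _) (subst (_≤ 2) (deg-removeAt S w) (S₂ w))

  ¬simplePath-deleteEdge : Acyclic T → ¬ SimplePath T∖e v u
  ¬simplePath-deleteEdge acyclic (xs , uniq , linked , end) =
    acyclic (v ∷ xs)
      (at-least-two xs linked end , uniq , Linked.map (λ (i , p) → punchIn e i , p) linked , u , end , e , inj₁ refl)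
    where
    at-least-two : ∀ xs → Linked (Adj T∖e) (v ∷ xs) → last (v ∷ xs) ≡ just u → 2 ≤ length xs
    at-least-two []       _           end = ⊥-elim (loopless T e (sym (just-injective end)))
    at-least-two (y ∷ []) (v~y ∷ [-]) end with just-injective end
    ... | refl with v~y
    ...   | i , inj₁ i≡vu = ⊥-elim (proj₂ (noMulti T (punchIn e i) e (punchInᵢ≢i e i)) i≡vu)
    ...   | i , inj₂ i≡uv = ⊥-elim (proj₁ (noMulti T (punchIn e i) e (punchInᵢ≢i e i)) i≡uv)
    at-least-two (_ ∷ _ ∷ _) _ _ = s≤s (s≤s z≤n)

  Separation : Set
  Separation = ∃[ A ] (ConstantOnEdges T∖e A × A u ≡ true × A v ≡ false)

  reachable-separation : Acyclic T → (∀ w → Dec (SimplePath T∖e w u)) → Separation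
  reachable-separation acyclic reach? = A , A-const , dec-true (reach? u) (simplePath-refl T∖e u) ,
                                        dec-false (reach? v) (¬simplePath-deleteEdge acyclic)
    where
    A : Fin n → Bool
    A w = does (reach? w)
    A-const : ConstantOnEdges T∖e A
    A-const i with reach? (proj₁ (edge T∖e i)) | reach? (proj₂ (edge T∖e i))
    ... | yes _ | yes _ = refl
    ... | no _  | no _  = refl
    ... | yes p | no ¬q = ⊥-elim (¬q (simplePath-∷ T∖e (i , inj₂ refl) p))
    ... | no ¬p | yes q = ⊥-elim (¬p (simplePath-∷ T∖e (i , inj₁ refl) q))

  -- Reachability need not be decidable constructively, but it is so up to double negation.
  acyclic⇒¬¬separation : Acyclic T → ¬ ¬ Separation
  acyclic⇒¬¬separation acyclic ¬sep =
    sequence (RawMonad.rawApplicative ¬¬-Monad) (λ _ → ¬¬-excluded-middle) (¬sep ∘ reachable-separation acyclic)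

  module _ {k k′ : ℕ} (ν : IsNu2 T k) (ν′ : IsNu2 T∖e k′) where

    ν₂-deleteEdge-≤ : k′ ≤ k
    ν₂-deleteEdge-≤ with proj₁ ν′
    ... | W′ , W′₂ , |W′| =
      subst (_≤ k) (trans (∣insertAt∣ W′ e false) |W′|)
        (proj₂ ν (insertAt W′ e false) (insertAt-false-2matching W′ W′₂))

    e∉⇒size≤ν₂′ : ∀ S → Is2Matching T S → lookup S e ≡ false → ∣ S ∣ ≤ k′
    e∉⇒size≤ν₂′ S S₂ e∉S = begin
      ∣ S ∣                                     ≡⟨ ∣removeAt∣ S e ⟩
      boolToℕ (lookup S e) + ∣ removeAt S e ∣   ≡⟨ cong (λ b → boolToℕ b + ∣ removeAt S e ∣) e∉S ⟩
      ∣ removeAt S e ∣                          ≤⟨ proj₂ ν′ (removeAt S e) (removeAt-2matching S S₂) ⟩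
      k′                                        ∎
      where open ≤-Reasoning

    ν₂-≤-suc : k ≤ suc k′
    ν₂-≤-suc with proj₁ ν
    ... | W , W₂ , |W| = begin
      k                                         ≡⟨ sym |W| ⟩
      ∣ W ∣                                     ≡⟨ ∣removeAt∣ W e ⟩
      boolToℕ (lookup W e) + ∣ removeAt W e ∣
        ≤⟨ +-mono-≤ (boolToℕ≤1 (lookup W e)) (proj₂ ν′ (removeAt W e) (removeAt-2matching W W₂)) ⟩
      suc k′                                    ∎
      where open ≤-Reasoning

    ν₂-deleteEdge-cases : k ≡ k′ ⊎ k ≡ suc k′
    ν₂-deleteEdge-cases with m≤n⇒m<n∨m≡n ν₂-≤-suc
    ... | inj₁ k<1+k′ = inj₁ (≤-antisym (s≤s⁻¹ k<1+k′) ν₂-deleteEdge-≤)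
    ... | inj₂ k≡1+k′ = inj₂ k≡1+k′

    ≡suc⇒saturatedEdge : k ≡ suc k′ → SaturatedEdge T e
    ≡suc⇒saturatedEdge k≡1+k′ S S-max with lookup S e in e∈S
    ... | true  = lookup⇒[]= e S e∈S
    ... | false = ⊥-elim (1+n≰n (begin
      suc k′ ≡⟨ sym k≡1+k′ ⟩
      k      ≡⟨ sym (maximum⇒size T ν S S-max) ⟩
      ∣ S ∣  ≤⟨ e∉⇒size≤ν₂′ S (proj₁ S-max) e∈S ⟩
      k′     ∎))
      where open ≤-Reasoning

    saturatedEdge⇒≡suc : SaturatedEdge T e → k ≡ suc k′
    saturatedEdge⇒≡suc e-sat with ν₂-deleteEdge-cases | proj₁ ν′
    ... | inj₂ k≡1+k′ | _               = k≡1+k′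
    ... | inj₁ k≡k′   | W′ , W′₂ , |W′| = ⊥-elim (true≢false (begin
      true                             ≡⟨ sym ([]=⇒lookup (e-sat S S-max)) ⟩
      lookup (insertAt W′ e false) e   ≡⟨ insertAt-lookup W′ e false ⟩
      false                            ∎))
      where
      open ≡-Reasoning
      S = insertAt W′ e false
      S-max : IsMaximum2Matching T S
      S-max = size⇒maximum T ν S (insertAt-false-2matching W′ W′₂)
                (trans (∣insertAt∣ W′ e false) (trans |W′| (sym k≡k′)))
      true≢false : true ≡ false → ⊥
      true≢false ()

    removeAt-maximum : k ≡ suc k′ → ∀ S → IsMaximum2Matching T S → IsMaximum2Matching T∖e (removeAt S e)
    removeAt-maximum k≡1+k′ S S-max =
      size⇒maximum T∖e ν′ (removeAt S e) (removeAt-2matching S (proj₁ S-max)) (suc-injective (begin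
        suc ∣ removeAt S e ∣                      ≡⟨ cong (λ b → boolToℕ b + ∣ removeAt S e ∣) (sym e∈S) ⟩
        boolToℕ (lookup S e) + ∣ removeAt S e ∣   ≡⟨ sym (∣removeAt∣ S e) ⟩
        ∣ S ∣                                     ≡⟨ maximum⇒size T ν S S-max ⟩
        k                                         ≡⟨ k≡1+k′ ⟩
        suc k′                                    ∎))
      where
      open ≡-Reasoning
      e∈S : lookup S e ≡ true
      e∈S = []=⇒lookup (≡suc⇒saturatedEdge k≡1+k′ S S-max)

    saturatedVertex⇒≡ : ∀ {w} → Incident T w e → SaturatedVertex T∖e w → k ≡ k′
    saturatedVertex⇒≡ {w} w∈e w-sat with ν₂-deleteEdge-cases | proj₁ ν
    ... | inj₁ k≡k′   | _            = k≡k′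
    ... | inj₂ k≡1+k′ | W , W₂ , |W| = ⊥-elim (1+n≰n (begin
      3                                                                   ≡⟨ cong₂ _+_ W-ends (sym W∖e-saturates) ⟩
      boolToℕ (lookup W e ∧ incidentᵇ T e w) + deg T∖e (removeAt W e) w   ≡⟨ sym (deg-removeAt W w) ⟩
      deg T W w                                                           ≤⟨ W₂ w ⟩
      2                                                                   ∎))
      where
      open ≤-Reasoning
      W-max : IsMaximum2Matching T W
      W-max = size⇒maximum T ν W W₂ |W|
      W-ends : 1 ≡ boolToℕ (lookup W e ∧ incidentᵇ T e w)
      W-ends = cong boolToℕ (sym (cong₂ _∧_ ([]=⇒lookup (≡suc⇒saturatedEdge k≡1+k′ W W-max))
                                           (Incident⇒incidentᵇ T w∈e)))
      W∖e-saturates : deg T∖e (removeAt W e) w ≡ 2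
      W∖e-saturates = w-sat (removeAt W e) (removeAt-maximum k≡1+k′ W W-max)

    unsaturated-endpoints⇒suc≤ : Separation → ∀ X Y →
      Is2Matching T∖e X → ∣ X ∣ ≡ k′ → deg T∖e X u ≤ 1 →
      Is2Matching T∖e Y → ∣ Y ∣ ≡ k′ → deg T∖e Y v ≤ 1 → suc k′ ≤ k
    unsaturated-endpoints⇒suc≤ (A , A-const , A-u , A-v) X Y X₂ |X| u≤1 Y₂ |Y| v≤1 = begin
      suc k′                 ≡⟨ cong suc (sym (∣glue∣-maximum T∖e A A-const X Y ν′ X₂ |X| Y₂ |Y|)) ⟩
      suc ∣ M ∣              ≡⟨ sym (∣insertAt∣ M e true) ⟩
      ∣ insertAt M e true ∣  ≤⟨ proj₂ ν (insertAt M e true) (insertAt-true-2matching M M₂ M-u M-v) ⟩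
      k                      ∎
      where
      open ≤-Reasoning
      M = glue T∖e A A-const X Y
      M₂ : Is2Matching T∖e M
      M₂ = glue-2matching T∖e A A-const X Y X₂ Y₂
      deg-M : ∀ w b → A w ≡ b → deg T∖e M w ≡ deg T∖e (if b then X else Y) w
      deg-M w b A-w = trans (deg-glue T∖e A A-const X Y w) (cong (λ c → deg T∖e (if c then X else Y) w) A-w)
      M-u : deg T∖e M u ≤ 1
      M-u = subst (_≤ 1) (sym (deg-M u true A-u)) u≤1
      M-v : deg T∖e M v ≤ 1
      M-v = subst (_≤ 1) (sym (deg-M v false A-v)) v≤1

    ≡⇒saturatedVertex : Acyclic T → k ≡ k′ → SaturatedVertex T∖e u ⊎ SaturatedVertex T∖e v
    ≡⇒saturatedVertex acyclic k≡k′ with saturated⊎unsaturating T∖e ν′ u | saturated⊎unsaturating T∖e ν′ v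
    ... | inj₁ u-sat | _          = inj₁ u-sat
    ... | inj₂ _     | inj₁ v-sat = inj₂ v-sat
    ... | inj₂ (X , X₂ , |X| , u≤1) | inj₂ (Y , Y₂ , |Y| , v≤1) = ⊥-elim (acyclic⇒¬¬separation acyclic λ sep →
      1+n≰n (subst (suc k′ ≤_) k≡k′ (unsaturated-endpoints⇒suc≤ sep X Y X₂ |X| u≤1 Y₂ |Y| v≤1)))

lemma2p4 : ∀ {n m} (T : Graph n (suc m)) → IsTree T → (e : Fin (suc m)) →
    let u = proj₁ (edge T e)
        v = proj₂ (edge T e)
    in ∀ (k k′ : ℕ) → IsNu2 T k → IsNu2 (deleteEdge T e) k′ →
       (k ≡ k′ ⊎ k ≡ suc k′) ×
       (k ≡ k′ ⇔ (SaturatedVertex (deleteEdge T e) u ⊎ SaturatedVertex (deleteEdge T e) v)) ×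
       (k ≡ suc k′ ⇔ SaturatedEdge T e)
lemma2p4 T (_ , acyclic) e k k′ ν ν′ =
    ν₂-deleteEdge-cases T e ν ν′
  , mk⇔ (≡⇒saturatedVertex T e ν ν′ acyclic)
        [ saturatedVertex⇒≡ T e ν ν′ (inj₁ refl) , saturatedVertex⇒≡ T e ν ν′ (inj₂ refl) ]
  , mk⇔ (≡suc⇒saturatedEdge T e ν ν′) (saturatedEdge⇒≡suc T e ν ν′)
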